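{- Let $m$ be a positive even integer and let $A, B\subseteq \mathbb{Z}_{m}$ satisfy $A\cup B=\mathbb{Z}_{m}$ and $|A\cap B|=2$ or $|A\cap B|=m-2$. Then $R_{A}(\overline{n})=R_{B}(\overline{n})$ for all $\overline{n}\in \mathbb{Z}_{m}$ if and only if $B=A+\overline{\frac{m}{2}}$.
   Context: $\mathbb{Z}_m$ denotes the set (group) of residue classes modulo $m$. For $A\subseteq\mathbb{Z}_m$ and $\overline{n}\in\mathbb{Z}_m$, $R_A(\overline{n})$ is the number of ordered pairs $(\overline{a},\overline{a'})\in A\times A$ with $\overline{a}+\overline{a'}=\overline{n}$. For $\overline{c}\in\mathbb{Z}_m$, $A+\overline{c}=\{\overline{a}+\overline{c}:\overline{a}\in A\}$. -}

module Defs where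

open import Data.Nat using (ℕ; NonZero)
open import Data.Nat.DivMod using (_mod_)
open import Data.Fin using (Fin; toℕ; _≟_)
open import Data.Fin.Subset using (Subset; _∈_)
open import Data.Fin.Subset.Properties using (_∈?_)
open import Data.Fin.Properties using (any?)
open import Data.List using (List; length; filter; cartesianProduct; allFin)
open import Data.Vec using (tabulate)
open import Data.Product using (_×_; _,_)
open import Relation.Nullary using (does)
open import Relation.Nullary.Decidable using (_×-dec_)
open import Relation.Binary.PropositionalEquality using (_≡_)

-- ℤ_m is represented by Fin m (residues 0..m-1).

[_]ₘ : ∀ {m} .{{_ : NonZero m}} → ℕ → Fin m
[_]ₘ {m} n = n mod m

_+ₘ_ : ∀ {m} .{{_ : NonZero m}} → Fin m → Fin m → Fin m
a +ₘ b = [ toℕ a + toℕ b ]ₘ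
  where open Data.Nat using (_+_)

R : ∀ {m} .{{_ : NonZero m}} → Subset m → Fin m → ℕ
R {m} A n = length (filter P? (cartesianProduct (allFin m) (allFin m)))
  where
  P? : (p : Fin m × Fin m) → _
  P? (a , a') = (a ∈? A) ×-dec ((a' ∈? A) ×-dec ((a +ₘ a') ≟ n))

_+ₛ_ : ∀ {m} .{{_ : NonZero m}} → Subset m → Fin m → Subset m
_+ₛ_ {m} A c = tabulate λ x → does (any? λ a → (a ∈? A) ×-dec ((a +ₘ c) ≟ x))

-- The argument works in any finite abelian group (carried here by Fin n).  With
-- d = 1_A − 1_B and s = 1_A + 1_B, the difference of squares for convolution gives
-- R_A − R_B = d ⋆ s, and A ∪ B = everything gives s = 1 + 1_{A∩B}.  When A ∩ B or its
-- complement is a two-point set {p, q}, s = α + β(δ_p + δ_q), so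
-- (d ⋆ s)(z) = α Σd + β (d(z − p) + d(z − q)).  If R_A = R_B this vanishes; evaluating
-- at z = p + q gives Σd = 0, hence d(z − p) + d(z − q) = 0 for all z.  For a cover this
-- says y ∈ B ⇔ y + r ∈ A with r = p − q, and looking at y = p shows r ≠ 0, 2r = 0.
-- Conversely a translate by an element of order two has the same representation
-- function.  In ℤ_m the only nonzero element of order two is m/2.
module Submission where

open import Defs
open import Data.Nat using (ℕ; NonZero; _∸_; _/_)
open import Data.Nat.Divisibility using (_∣_)
open import Data.Fin using (Fin)
open import Data.Fin.Subset using (Subset; _∪_; _∩_; ∣_∣; ⊤)
open import Data.Sum using (_⊎_)
open import Function.Bundles using (_⇔_)
open import Relation.Binary.PropositionalEquality using (_≡_)

open import Data.Nat using (zero; suc; _%_)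
import Data.Nat as ℕ
import Data.Nat.Properties as ℕ
import Data.Nat.DivMod as ℕ
open import Data.Nat.Divisibility using (divides; m%n≡0⇒n∣m; ∣⇒≤)
open import Data.Integer using (ℤ; +_; 0ℤ; 1ℤ; -1ℤ; _+_; _*_; -_; _-_)
open import Data.Integer.Properties using (+-*-semiring; +-identityˡ; +-identityʳ; *-identityˡ; *-identityʳ;
  *-zeroʳ; *-comm; *-distribˡ-+; +-inverseʳ; -1*i≡-i; +-injective)
open import Data.Integer.Tactic.RingSolver using (solve-∀)
open import Data.Bool using (Bool; true; false; _∧_; _∨_; not)
open import Data.Bool.Properties using (∧-comm; not-injective; not-involutive)
open import Data.Fin using (_≟_; toℕ) renaming (zero to fzero; suc to fsuc)
open import Data.Fin.Properties using (suc-injective; toℕ-injective; toℕ-fromℕ<; toℕ<n; any?)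
open import Data.Fin.Permutation using (permutation)
open import Data.Fin.Subset using (∁; _∈_)
open import Data.Fin.Subset.Properties using (_∈?_; ∣∁p∣≡n∸∣p∣)
open import Data.List using (length; filter; tabulate; cartesianProduct; map; _++_; allFin)
open import Data.List.Properties using (filter-++; length-++; map-tabulate)
open import Data.Vec using (lookup; _∷_)
open import Data.Vec.Properties using (lookup-zipWith; lookup-map; lookup-replicate; lookup∘tabulate;
  tabulate∘lookup; tabulate-cong; []=⇒lookup; lookup⇒[]=)
open import Data.Product using (Σ; ∃; _×_; _,_; proj₁; proj₂)
open import Data.Sum using (inj₁; inj₂; map₂)
open import Function using (id)
open import Function.Bundles using (Equivalence; mk⇔)
open import Level using (0ℓ)
open import Relation.Nullary using (Dec; does; yes; no)
open import Relation.Nullary.Decidable using (_×-dec_)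
open import Relation.Nullary.Negation using (contradiction)
open import Relation.Unary using (Pred; Decidable)
open import Relation.Binary.PropositionalEquality
  using (_≢_; refl; sym; trans; cong; cong₂; subst; subst₂; isEquivalence; module ≡-Reasoning)
open import Algebra.Core using (Op₁; Op₂)
open import Algebra.Bundles using (AbelianGroup)
open import Algebra.Structures using (IsAbelianGroup)
open import Algebra.Consequences.Propositional using (comm∧idˡ⇒id; comm∧invˡ⇒inv)
open import Algebra.Properties.Semiring.Sum +-*-semiring
  using (sum; sum-cong-≗; sum-replicate-zero; ∑-distrib-+; ∑-permute; *-distribˡ-sum)

open ≡-Reasoning

⟦_⟧ : Bool → ℤ
⟦ true ⟧ = 1ℤ
⟦ false ⟧ = 0ℤ

δ : ∀ {n} → Fin n → Fin n → ℤ
δ p y = ⟦ does (y ≟ p) ⟧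

∑-δ : ∀ {n} (f : Fin n → ℤ) (p : Fin n) → sum (λ y → f y * δ p y) ≡ f p
∑-δ {suc n} f fzero = begin
  f fzero * 1ℤ + sum (λ y → f (fsuc y) * 0ℤ)   ≡⟨ cong₂ _+_ (*-identityʳ (f fzero)) rest≡0 ⟩
  f fzero + 0ℤ                                  ≡⟨ +-identityʳ (f fzero) ⟩
  f fzero                                       ∎
  where
  rest≡0 : sum (λ y → f (fsuc y) * 0ℤ) ≡ 0ℤ
  rest≡0 = trans (sum-cong-≗ (λ y → *-zeroʳ (f (fsuc y)))) (sum-replicate-zero n)
∑-δ {suc n} f (fsuc p) = begin
  f fzero * 0ℤ + sum (λ y → f (fsuc y) * δ p y)  ≡⟨ cong₂ _+_ (*-zeroʳ (f fzero)) (∑-δ (λ y → f (fsuc y)) p) ⟩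
  0ℤ + f (fsuc p)                                 ≡⟨ +-identityˡ (f (fsuc p)) ⟩
  f (fsuc p)                                      ∎

∑-reindex : ∀ {n} (σ τ : Fin n → Fin n) → (∀ x → σ (τ x) ≡ x) → (∀ x → τ (σ x) ≡ x) →
            (f : Fin n → ℤ) → sum f ≡ sum (λ x → f (σ x))
∑-reindex σ τ στ τσ f = ∑-permute f (permutation σ τ στ τσ)

∑-distrib-- : ∀ {n} (f g : Fin n → ℤ) → sum (λ x → f x - g x) ≡ sum f - sum g
∑-distrib-- f g = begin
  sum (λ x → f x - g x)        ≡⟨ ∑-distrib-+ f (λ x → - g x) ⟩
  sum f + sum (λ x → - g x)    ≡⟨ cong (λ t → sum f + t) (sum-cong-≗ (λ x → sym (-1*i≡-i (g x)))) ⟩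
  sum f + sum (λ x → -1ℤ * g x) ≡⟨ cong (λ t → sum f + t) (sym (*-distribˡ-sum -1ℤ g)) ⟩
  sum f + -1ℤ * sum g          ≡⟨ cong (λ t → sum f + t) (-1*i≡-i (sum g)) ⟩
  sum f - sum g                ∎

module _ {X : Set} {P : Pred X 0ℓ} (P? : Decidable P) where

  count-tabulate : ∀ {n} (f : Fin n → X) → + length (filter P? (tabulate f)) ≡ sum (λ j → ⟦ does (P? (f j)) ⟧)
  count-tabulate {zero} f = refl
  count-tabulate {suc n} f with does (P? (f fzero))
  ... | true = cong (λ t → 1ℤ + t) (count-tabulate (λ j → f (fsuc j)))
  ... | false = trans (count-tabulate (λ j → f (fsuc j))) (sym (+-identityˡ _))

module _ {Y Z : Set} {P : Pred (Y × Z) 0ℓ} (P? : Decidable P) where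

  count-cartesianProduct : ∀ {m n} (g : Fin m → Y) (h : Fin n → Z) →
    + length (filter P? (cartesianProduct (tabulate g) (tabulate h))) ≡
    sum (λ i → sum (λ j → ⟦ does (P? (g i , h j)) ⟧))
  count-cartesianProduct {zero} g h = refl
  count-cartesianProduct {suc m} g h = begin
    + length (filter P? (row ++ rest))                       ≡⟨ cong (λ l → + length l) (filter-++ P? row rest) ⟩
    + length (filter P? row ++ filter P? rest)               ≡⟨ cong +_ (length-++ (filter P? row)) ⟩
    + length (filter P? row) + + length (filter P? rest)
        ≡⟨ cong₂ _+_ count-row (count-cartesianProduct (λ i → g (fsuc i)) h) ⟩
    sum (λ j → ⟦ does (P? (g fzero , h j)) ⟧) + sum (λ i → sum (λ j → ⟦ does (P? (g (fsuc i) , h j)) ⟧)) ∎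
    where
    row = map (g fzero ,_) (tabulate h)
    rest = cartesianProduct (tabulate (λ i → g (fsuc i))) (tabulate h)
    count-row : + length (filter P? row) ≡ sum (λ j → ⟦ does (P? (g fzero , h j)) ⟧)
    count-row = trans (cong (λ l → + length (filter P? l)) (map-tabulate h (g fzero ,_))) (count-tabulate P? (λ j → g fzero , h j))

δ-cong : ∀ {n} {p y p′ y′ : Fin n} → (y ≡ p → y′ ≡ p′) → (y′ ≡ p′ → y ≡ p) → δ p y ≡ δ p′ y′
δ-cong {p = p} {y} {p′} {y′} to from with y ≟ p | y′ ≟ p′
... | yes _   | yes _    = refl
... | no _    | no _     = refl
... | yes y≡p | no y′≢p′ = contradiction (to y≡p) y′≢p′
... | no y≢p  | yes y′≡p′ = contradiction (from y′≡p′) y≢p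

does-∈? : ∀ {n} (x : Fin n) (A : Subset n) → does (x ∈? A) ≡ lookup A x
does-∈? fzero    (true ∷ A)  = refl
does-∈? fzero    (false ∷ A) = refl
does-∈? (fsuc x) (_ ∷ A)     = does-∈? x A

cover-sum : ∀ a b → a ∨ b ≡ true → ⟦ a ⟧ + ⟦ b ⟧ ≡ 1ℤ + ⟦ a ∧ b ⟧
cover-sum true  true  _ = refl
cover-sum true  false _ = refl
cover-sum false true  _ = refl

both⇒difference≡0 : ∀ a b → a ∧ b ≡ true → ⟦ a ⟧ - ⟦ b ⟧ ≡ 0ℤ
both⇒difference≡0 true true _ = refl

cover-opposite : ∀ a b c d → a ∨ b ≡ true → c ∨ d ≡ true →
                 (⟦ a ⟧ - ⟦ b ⟧) + (⟦ c ⟧ - ⟦ d ⟧) ≡ 0ℤ → b ≡ c × a ≡ d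
cover-opposite true  true  true  true  _ _ _ = refl , refl
cover-opposite true  false false true  _ _ _ = refl , refl
cover-opposite false true  true  false _ _ _ = refl , refl
cover-opposite true  true  true  false _ _ ()
cover-opposite true  true  false true  _ _ ()
cover-opposite true  false true  true  _ _ ()
cover-opposite true  false true  false _ _ ()
cover-opposite false true  true  true  _ _ ()
cover-opposite false true  false true  _ _ ()

⟦not⟧ : ∀ u → ⟦ not u ⟧ ≡ 1ℤ - ⟦ u ⟧
⟦not⟧ true  = refl
⟦not⟧ false = refl

⟦∧⟧ : ∀ a b → ⟦ a ∧ b ⟧ ≡ ⟦ a ⟧ * ⟦ b ⟧
⟦∧⟧ true  b = sym (*-identityˡ ⟦ b ⟧)
⟦∧⟧ false b = refl

pair : ∀ {n} → Fin n → Fin n → Fin n → Bool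
pair p q y = does (y ≟ p) ∨ does (y ≟ q)

pair-left : ∀ {n} (p q : Fin n) → pair p q p ≡ true
pair-left p q with p ≟ p
... | yes _  = refl
... | no p≢p = contradiction refl p≢p

pair-right : ∀ {n} (p q : Fin n) → pair p q q ≡ true
pair-right p q with q ≟ p | q ≟ q
... | yes _ | _     = refl
... | no _  | yes _ = refl
... | no _  | no q≢q = contradiction refl q≢q

pair-cases : ∀ {n} {p q y : Fin n} → pair p q y ≡ true → y ≡ p ⊎ y ≡ q
pair-cases {p = p} {q} {y} y∈pq with y ≟ p | y ≟ q | y∈pq
... | yes y≡p | _       | _ = inj₁ y≡p
... | no _    | yes y≡q | _ = inj₂ y≡q

⟦pair⟧ : ∀ {n} {p q : Fin n} → p ≢ q → ∀ y → ⟦ pair p q y ⟧ ≡ δ p y + δ q y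
⟦pair⟧ {p = p} {q} p≢q y with y ≟ p | y ≟ q
... | yes y≡p | yes y≡q = contradiction (trans (sym y≡p) y≡q) p≢q
... | yes _   | no _    = refl
... | no _    | yes _   = refl
... | no _    | no _    = refl

one-element : ∀ {n} (v : Subset n) → ∣ v ∣ ≡ 1 → Σ (Fin n) λ p → ∀ y → lookup v y ≡ does (y ≟ p)
one-element (true ∷ v) ∣v∣≡1 = fzero , λ { fzero → refl ; (fsuc y) → empty v (ℕ.suc-injective ∣v∣≡1) y }
  where
  empty : ∀ {n} (v : Subset n) → ∣ v ∣ ≡ 0 → ∀ y → lookup v y ≡ false
  empty (false ∷ v) ∣v∣≡0 fzero = refl
  empty (false ∷ v) ∣v∣≡0 (fsuc y) = empty v ∣v∣≡0 y
one-element (false ∷ v) ∣v∣≡1 with one-element v ∣v∣≡1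
... | p , v≡⁅p⁆ = fsuc p , λ { fzero → refl ; (fsuc y) → v≡⁅p⁆ y }

two-element : ∀ {n} (v : Subset n) → ∣ v ∣ ≡ 2 →
              Σ (Fin n) λ p → Σ (Fin n) λ q → p ≢ q × (∀ y → lookup v y ≡ pair p q y)
two-element (true ∷ v) ∣v∣≡2 with one-element v (ℕ.suc-injective ∣v∣≡2)
... | p , v≡⁅p⁆ = fzero , fsuc p , (λ ()) , λ { fzero → refl ; (fsuc y) → v≡⁅p⁆ y }
two-element (false ∷ v) ∣v∣≡2 with two-element v ∣v∣≡2
... | p , q , p≢q , v≡pq = fsuc p , fsuc q , (λ e → p≢q (suc-injective e)) , λ { fzero → refl ; (fsuc y) → v≡pq y }

module OnAbelianGroup {n : ℕ} {_∙_ : Op₂ (Fin n)} {ε : Fin n} {_⁻¹ : Op₁ (Fin n)}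
                      (isAbelianGroup : IsAbelianGroup _≡_ _∙_ ε _⁻¹) where

  G : AbelianGroup 0ℓ 0ℓ
  G = record { isAbelianGroup = isAbelianGroup }

  open AbelianGroup G using (assoc; comm; identityʳ; inverseʳ)

  open import Algebra.Properties.AbelianGroup G using (//-rightDividesˡ; //-rightDividesʳ; x∙y⁻¹≈ε⇒x≈y; inverseʳ-unique)
  open import Algebra.Properties.CommutativeSemigroup (AbelianGroup.commutativeSemigroup G) using (interchange)

  infixl 6 _⊖_
  _⊖_ : Op₂ (Fin n)
  x ⊖ y = x ∙ (y ⁻¹)

  ⊖-unique : ∀ {x y z} → x ∙ y ≡ z → y ≡ z ⊖ x
  ⊖-unique {x} {y} xy≡z = trans (sym (//-rightDividesʳ x y)) (cong (_⊖ x) (trans (comm y x) xy≡z))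

  ⊖-solves : ∀ x z → x ∙ (z ⊖ x) ≡ z
  ⊖-solves x z = trans (comm x (z ⊖ x)) (//-rightDividesˡ x z)

  ⊖-flip : ∀ {z x y} → z ⊖ x ≡ y → z ⊖ y ≡ x
  ⊖-flip {z} {x} {y} z⊖x≡y = sym (⊖-unique (begin
    y ∙ x        ≡⟨ comm y x ⟩
    x ∙ y        ≡⟨ cong (x ∙_) z⊖x≡y ⟨
    x ∙ (z ⊖ x)  ≡⟨ ⊖-solves x z ⟩
    z            ∎))

  ⊖-involutive : ∀ z x → z ⊖ (z ⊖ x) ≡ x
  ⊖-involutive z x = ⊖-flip refl

  ⊖-order-two : ∀ {c} → c ∙ c ≡ ε → ∀ y → y ⊖ c ≡ y ∙ c
  ⊖-order-two {c} c∙c≡ε y = cong (y ∙_) (sym (inverseʳ-unique c c c∙c≡ε))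

  infixl 7 _⋆_
  _⋆_ : (Fin n → ℤ) → (Fin n → ℤ) → Fin n → ℤ
  (f ⋆ g) z = sum (λ x → f x * g (z ⊖ x))

  -- Convolution is commutative: reindex by the involution x ↦ z ⊖ x.
  ⋆-comm : ∀ f g z → (f ⋆ g) z ≡ (g ⋆ f) z
  ⋆-comm f g z = begin
    sum (λ x → f x * g (z ⊖ x))               ≡⟨ ∑-reindex (z ⊖_) (z ⊖_) (⊖-involutive z) (⊖-involutive z) _ ⟩
    sum (λ x → f (z ⊖ x) * g (z ⊖ (z ⊖ x)))   ≡⟨ sum-cong-≗ swap ⟩
    sum (λ x → g x * f (z ⊖ x))               ∎
    where
    swap : ∀ x → f (z ⊖ x) * g (z ⊖ (z ⊖ x)) ≡ g x * f (z ⊖ x)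
    swap x = trans (*-comm (f (z ⊖ x)) _) (cong (λ y → g y * f (z ⊖ x)) (⊖-involutive z x))

  -- Used with (α , β) = (1 , 1)
  -- and (2 , −1), the two shapes of s = 1 + 1_{A∩B}.
  ⋆-two-point : ∀ (α β : ℤ) (p q : Fin n) (f g : Fin n → ℤ) → (∀ y → g y ≡ α + β * (δ p y + δ q y)) →
                ∀ z → (f ⋆ g) z ≡ α * sum f + β * (f (z ⊖ p) + f (z ⊖ q))
  ⋆-two-point α β p q f g g≡ z = begin
    sum (λ x → f x * g (z ⊖ x))                                 ≡⟨ sum-cong-≗ expand ⟩
    sum (λ x → α * f x + β * (f x * δ (z ⊖ p) x + f x * δ (z ⊖ q) x))
        ≡⟨ ∑-distrib-+ (λ x → α * f x) (λ x → β * (f x * δ (z ⊖ p) x + f x * δ (z ⊖ q) x)) ⟩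
    sum (λ x → α * f x) + sum (λ x → β * (f x * δ (z ⊖ p) x + f x * δ (z ⊖ q) x))
        ≡⟨ sym (cong₂ _+_ (*-distribˡ-sum α f) (*-distribˡ-sum β (λ x → f x * δ (z ⊖ p) x + f x * δ (z ⊖ q) x))) ⟩
    α * sum f + β * sum (λ x → f x * δ (z ⊖ p) x + f x * δ (z ⊖ q) x)
        ≡⟨ cong (λ t → α * sum f + β * t) (∑-distrib-+ (λ x → f x * δ (z ⊖ p) x) (λ x → f x * δ (z ⊖ q) x)) ⟩
    α * sum f + β * (sum (λ x → f x * δ (z ⊖ p) x) + sum (λ x → f x * δ (z ⊖ q) x))
        ≡⟨ cong (λ t → α * sum f + β * t) (cong₂ _+_ (∑-δ f (z ⊖ p)) (∑-δ f (z ⊖ q))) ⟩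
    α * sum f + β * (f (z ⊖ p) + f (z ⊖ q))                     ∎
    where
    -- δ_p (z ⊖ x) = δ_{z ⊖ p} x, since z ⊖ x = p iff z ⊖ p = x.
    δ-reflect : ∀ r x → δ r (z ⊖ x) ≡ δ (z ⊖ r) x
    δ-reflect r x = δ-cong (λ e → sym (⊖-flip e)) (λ e → ⊖-flip (sym e))
    distribute : ∀ d α β u v → d * (α + β * (u + v)) ≡ α * d + β * (d * u + d * v)
    distribute = solve-∀
    expand : ∀ x → f x * g (z ⊖ x) ≡ α * f x + β * (f x * δ (z ⊖ p) x + f x * δ (z ⊖ q) x)
    expand x = begin
      f x * g (z ⊖ x)                                   ≡⟨ cong (f x *_) (g≡ (z ⊖ x)) ⟩
      f x * (α + β * (δ p (z ⊖ x) + δ q (z ⊖ x)))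
          ≡⟨ cong (λ t → f x * (α + β * t)) (cong₂ _+_ (δ-reflect p x) (δ-reflect q x)) ⟩
      f x * (α + β * (δ (z ⊖ p) x + δ (z ⊖ q) x))       ≡⟨ distribute (f x) α β _ _ ⟩
      α * f x + β * (f x * δ (z ⊖ p) x + f x * δ (z ⊖ q) x) ∎

  -- Difference of squares for convolution: a⋆a − b⋆b = (a − b) ⋆ (a + b),
  -- the cross terms a⋆b and b⋆a cancelling by commutativity.
  ⋆-difference-of-squares : ∀ a b z → ((λ x → a x - b x) ⋆ (λ x → a x + b x)) z ≡ (a ⋆ a) z - (b ⋆ b) z
  ⋆-difference-of-squares a b z = begin
    sum (λ x → (a x - b x) * (a (z ⊖ x) + b (z ⊖ x)))          ≡⟨ sum-cong-≗ split ⟩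
    sum (λ x → squares x + cross x)                          ≡⟨ ∑-distrib-+ squares cross ⟩
    sum squares + sum cross
        ≡⟨ cong₂ _+_ (∑-distrib-- (λ x → a x * a (z ⊖ x)) (λ x → b x * b (z ⊖ x)))
                     (∑-distrib-- (λ x → a x * b (z ⊖ x)) (λ x → b x * a (z ⊖ x))) ⟩
    ((a ⋆ a) z - (b ⋆ b) z) + ((a ⋆ b) z - (b ⋆ a) z)
        ≡⟨ cong (λ t → ((a ⋆ a) z - (b ⋆ b) z) + ((a ⋆ b) z - t)) (⋆-comm b a z) ⟩
    ((a ⋆ a) z - (b ⋆ b) z) + ((a ⋆ b) z - (a ⋆ b) z)
        ≡⟨ cong (λ t → ((a ⋆ a) z - (b ⋆ b) z) + t) (+-inverseʳ ((a ⋆ b) z)) ⟩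
    ((a ⋆ a) z - (b ⋆ b) z) + 0ℤ                             ≡⟨ +-identityʳ _ ⟩
    (a ⋆ a) z - (b ⋆ b) z                                    ∎
    where
    squares cross : Fin n → ℤ
    squares x = a x * a (z ⊖ x) - b x * b (z ⊖ x)
    cross x = a x * b (z ⊖ x) - b x * a (z ⊖ x)
    expand : ∀ p q r s → (p - q) * (r + s) ≡ (p * r - q * s) + (p * s - q * r)
    expand = solve-∀
    split : ∀ x → (a x - b x) * (a (z ⊖ x) + b (z ⊖ x)) ≡ squares x + cross x
    split x = expand (a x) (b x) (a (z ⊖ x)) (b (z ⊖ x))

  ⋆-translate : ∀ f g c → (∀ y → g y ≡ f (y ∙ c)) → ∀ z → (g ⋆ g) z ≡ (f ⋆ f) (z ∙ (c ∙ c))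
  ⋆-translate f g c g≡ z = begin
    sum (λ x → g x * g (z ⊖ x))
        ≡⟨ sum-cong-≗ (λ x → cong₂ _*_ (g≡ x) (trans (g≡ (z ⊖ x)) (cong f (shift x)))) ⟩
    sum (λ x → f (x ∙ c) * f (w ⊖ (x ∙ c)))  ≡⟨ ∑-reindex (_∙ c) (_⊖ c) (//-rightDividesˡ c) (//-rightDividesʳ c) _ ⟨
    sum (λ x → f x * f (w ⊖ x))              ∎
    where
    w = z ∙ (c ∙ c)
    shift : ∀ x → (z ⊖ x) ∙ c ≡ w ⊖ (x ∙ c)
    shift x = ⊖-unique (trans (interchange x c (z ⊖ x) c) (cong (_∙ (c ∙ c)) (⊖-solves x z)))

  𝟙 : Subset n → Fin n → ℤ
  𝟙 A y = ⟦ lookup A y ⟧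

  rep : Subset n → Fin n → ℤ
  rep A = 𝟙 A ⋆ 𝟙 A

  sums-to? : (A : Subset n) (z : Fin n) (p : Fin n × Fin n) →
             Dec (proj₁ p ∈ A × proj₂ p ∈ A × proj₁ p ∙ proj₂ p ≡ z)
  sums-to? A z (x , y) = (x ∈? A) ×-dec ((y ∈? A) ×-dec (x ∙ y ≟ z))

  count-pairs≡rep : ∀ A z → + length (filter (sums-to? A z) (cartesianProduct (allFin n) (allFin n))) ≡ rep A z
  count-pairs≡rep A z = begin
    + length (filter (sums-to? A z) (cartesianProduct (allFin n) (allFin n)))
        ≡⟨ count-cartesianProduct (sums-to? A z) id id ⟩
    sum (λ x → sum (λ y → ⟦ does (x ∈? A) ∧ (does (y ∈? A) ∧ does (x ∙ y ≟ z)) ⟧))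
        ≡⟨ sum-cong-≗ (λ x → sum-cong-≗ (λ y → indicators x y)) ⟩
    sum (λ x → sum (λ y → 𝟙 A x * (𝟙 A y * δ (z ⊖ x) y)))
        ≡⟨ sum-cong-≗ (λ x → *-distribˡ-sum (𝟙 A x) (λ y → 𝟙 A y * δ (z ⊖ x) y)) ⟨
    sum (λ x → 𝟙 A x * sum (λ y → 𝟙 A y * δ (z ⊖ x) y))
        ≡⟨ sum-cong-≗ (λ x → cong (𝟙 A x *_) (∑-δ (𝟙 A) (z ⊖ x))) ⟩
    sum (λ x → 𝟙 A x * 𝟙 A (z ⊖ x))                          ∎
    where
    indicators : ∀ x y → ⟦ does (x ∈? A) ∧ (does (y ∈? A) ∧ does (x ∙ y ≟ z)) ⟧ ≡
                         𝟙 A x * (𝟙 A y * δ (z ⊖ x) y)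
    indicators x y = begin
      ⟦ does (x ∈? A) ∧ (does (y ∈? A) ∧ does (x ∙ y ≟ z)) ⟧    ≡⟨ ⟦∧⟧ (does (x ∈? A)) _ ⟩
      ⟦ does (x ∈? A) ⟧ * ⟦ does (y ∈? A) ∧ does (x ∙ y ≟ z) ⟧
          ≡⟨ cong (⟦ does (x ∈? A) ⟧ *_) (⟦∧⟧ (does (y ∈? A)) _) ⟩
      ⟦ does (x ∈? A) ⟧ * (⟦ does (y ∈? A) ⟧ * δ z (x ∙ y))
          ≡⟨ cong₂ (λ u v → ⟦ u ⟧ * (⟦ v ⟧ * δ z (x ∙ y))) (does-∈? x A) (does-∈? y A) ⟩
      𝟙 A x * (𝟙 A y * δ z (x ∙ y))
          ≡⟨ cong (λ t → 𝟙 A x * (𝟙 A y * t)) (δ-cong ⊖-unique (λ e → trans (cong (x ∙_) e) (⊖-solves x z))) ⟩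
      𝟙 A x * (𝟙 A y * δ (z ⊖ x) y)                             ∎

  rep-translate : ∀ A B c → c ∙ c ≡ ε → (∀ y → lookup B y ≡ lookup A (y ∙ c)) → ∀ z → rep B z ≡ rep A z
  rep-translate A B c cc≡ε B≡A+c z = begin
    rep B z             ≡⟨ ⋆-translate (𝟙 A) (𝟙 B) c (λ y → cong ⟦_⟧ (B≡A+c y)) z ⟩
    rep A (z ∙ (c ∙ c)) ≡⟨ cong (λ w → rep A (z ∙ w)) cc≡ε ⟩
    rep A (z ∙ ε)       ≡⟨ cong (rep A) (identityʳ z) ⟩
    rep A z             ∎

  -- Two subsets A, B covering the group.  With d = 1_A − 1_B and s = 1_A + 1_B we have
  -- rep A − rep B = d ⋆ s, and s = 1 + 1_{A∩B} because every point lies in A or B.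
  module Covering (A B : Subset n) (cover : ∀ y → lookup A y ∨ lookup B y ≡ true) where

    d s : Fin n → ℤ
    d y = 𝟙 A y - 𝟙 B y
    s y = 𝟙 A y + 𝟙 B y

    both : Fin n → Bool
    both y = lookup A y ∧ lookup B y

    s≡1+both : ∀ y → s y ≡ 1ℤ + ⟦ both y ⟧
    s≡1+both y = cover-sum (lookup A y) (lookup B y) (cover y)

    equal-rep⇒d⋆s≡0 : (∀ z → rep A z ≡ rep B z) → ∀ z → (d ⋆ s) z ≡ 0ℤ
    equal-rep⇒d⋆s≡0 rA≡rB z = begin
      (d ⋆ s) z          ≡⟨ ⋆-difference-of-squares (𝟙 A) (𝟙 B) z ⟩
      rep A z - rep B z  ≡⟨ cong (λ t → t - rep B z) (rA≡rB z) ⟩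
      rep B z - rep B z  ≡⟨ +-inverseʳ (rep B z) ⟩
      0ℤ                 ∎

    ⊖-left : ∀ p q → (p ∙ q) ⊖ p ≡ q
    ⊖-left p q = sym (⊖-unique refl)

    ⊖-right : ∀ p q → (p ∙ q) ⊖ q ≡ p
    ⊖-right p q = sym (⊖-unique (comm q p))

    -- Here s = 1 + δ_p + δ_q, so d ⋆ s = Σd + d(z ⊖ p) + d(z ⊖ q); at z = p ∙ q the
    -- last two terms are d q + d p = 0 (both points lie in A ∩ B), hence Σd = 0.
    small-intersection : ∀ {p q} → p ≢ q → (∀ y → both y ≡ pair p q y) → (∀ z → (d ⋆ s) z ≡ 0ℤ) →
                         ∀ z → d (z ⊖ p) + d (z ⊖ q) ≡ 0ℤ
    small-intersection {p} {q} p≢q both≡pair d⋆s≡0 z = begin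
      d (z ⊖ p) + d (z ⊖ q)                       ≡⟨ only-second _ ⟩
      1ℤ * 0ℤ + 1ℤ * (d (z ⊖ p) + d (z ⊖ q))
          ≡⟨ cong (λ t → 1ℤ * t + 1ℤ * (d (z ⊖ p) + d (z ⊖ q))) ∑d≡0 ⟨
      1ℤ * sum d + 1ℤ * (d (z ⊖ p) + d (z ⊖ q))   ≡⟨ formula z ⟩
      0ℤ                                          ∎
      where
      only-first : ∀ σ → σ ≡ 1ℤ * σ + 1ℤ * (0ℤ + 0ℤ)
      only-first = solve-∀
      only-second : ∀ u → u ≡ 1ℤ * 0ℤ + 1ℤ * u
      only-second = solve-∀
      shape : ∀ y → s y ≡ 1ℤ + 1ℤ * (δ p y + δ q y)
      shape y = trans (s≡1+both y) (cong (λ t → 1ℤ + t)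
                  (trans (cong ⟦_⟧ (both≡pair y)) (trans (⟦pair⟧ p≢q y) (sym (*-identityˡ _)))))
      formula : ∀ z → 1ℤ * sum d + 1ℤ * (d (z ⊖ p) + d (z ⊖ q)) ≡ 0ℤ
      formula z = trans (sym (⋆-two-point 1ℤ 1ℤ p q d s shape z)) (d⋆s≡0 z)
      d≡0 : ∀ {y} → pair p q y ≡ true → d y ≡ 0ℤ
      d≡0 {y} y∈pq = both⇒difference≡0 (lookup A y) (lookup B y) (trans (both≡pair y) y∈pq)
      ∑d≡0 : sum d ≡ 0ℤ
      ∑d≡0 = begin
        sum d                                                    ≡⟨ only-first (sum d) ⟩
        1ℤ * sum d + 1ℤ * (0ℤ + 0ℤ)
            ≡⟨ cong (λ t → 1ℤ * sum d + 1ℤ * t) (cong₂ _+_ (d≡0 (pair-right p q)) (d≡0 (pair-left p q))) ⟨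
        1ℤ * sum d + 1ℤ * (d q + d p)
            ≡⟨ cong (λ t → 1ℤ * sum d + 1ℤ * t) (cong₂ _+_ (cong d (⊖-left p q)) (cong d (⊖-right p q))) ⟨
        1ℤ * sum d + 1ℤ * (d ((p ∙ q) ⊖ p) + d ((p ∙ q) ⊖ q))    ≡⟨ formula (p ∙ q) ⟩
        0ℤ                                                       ∎

    -- If A ∩ B is the complement of {p , q} and d ⋆ s = 0, then again d(z ⊖ p) + d(z ⊖ q) = 0.
    -- Now s = 2 − δ_p − δ_q and d is supported on {p , q}, so Σd = d p + d q; at z = p ∙ q
    -- we get 0 = 2Σd − (d q + d p) = Σd.
    large-intersection : ∀ {p q} → p ≢ q → (∀ y → both y ≡ not (pair p q y)) → (∀ z → (d ⋆ s) z ≡ 0ℤ) →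
                         ∀ z → d (z ⊖ p) + d (z ⊖ q) ≡ 0ℤ
    large-intersection {p} {q} p≢q both≡copair d⋆s≡0 z = begin
      d (z ⊖ p) + d (z ⊖ q)                               ≡⟨ only-second _ ⟩
      - (+ 2 * 0ℤ + -1ℤ * (d (z ⊖ p) + d (z ⊖ q)))
          ≡⟨ cong (λ t → - (+ 2 * t + -1ℤ * (d (z ⊖ p) + d (z ⊖ q)))) ∑d≡0 ⟨
      - (+ 2 * sum d + -1ℤ * (d (z ⊖ p) + d (z ⊖ q)))     ≡⟨ cong -_ (formula z) ⟩
      0ℤ                                                  ∎
      where
      only-second : ∀ u → u ≡ - (+ 2 * 0ℤ + -1ℤ * u)
      only-second = solve-∀
      complement : ∀ u → 1ℤ + (1ℤ - u) ≡ + 2 + -1ℤ * u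
      complement = solve-∀
      halve : ∀ u v → u + v ≡ + 2 * (u + v) + -1ℤ * (v + u)
      halve = solve-∀
      shape : ∀ y → s y ≡ + 2 + -1ℤ * (δ p y + δ q y)
      shape y = begin
        s y                            ≡⟨ s≡1+both y ⟩
        1ℤ + ⟦ both y ⟧                ≡⟨ cong (λ b → 1ℤ + ⟦ b ⟧) (both≡copair y) ⟩
        1ℤ + ⟦ not (pair p q y) ⟧
            ≡⟨ cong (λ t → 1ℤ + t) (trans (⟦not⟧ (pair p q y)) (cong (λ t → 1ℤ - t) (⟦pair⟧ p≢q y))) ⟩
        1ℤ + (1ℤ - (δ p y + δ q y))    ≡⟨ complement (δ p y + δ q y) ⟩
        + 2 + -1ℤ * (δ p y + δ q y)    ∎
      formula : ∀ z → + 2 * sum d + -1ℤ * (d (z ⊖ p) + d (z ⊖ q)) ≡ 0ℤ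
      formula z = trans (sym (⋆-two-point (+ 2) -1ℤ p q d s shape z)) (d⋆s≡0 z)
      supported : ∀ y → d y ≡ d y * ⟦ pair p q y ⟧
      supported y with pair p q y | both≡copair y
      ... | true  | _     = sym (*-identityʳ (d y))
      ... | false | y∈A∩B = trans (both⇒difference≡0 (lookup A y) (lookup B y) y∈A∩B) (sym (*-zeroʳ (d y)))
      on-pair : ∀ y → d y ≡ d y * δ p y + d y * δ q y
      on-pair y = trans (supported y) (trans (cong (d y *_) (⟦pair⟧ p≢q y)) (*-distribˡ-+ (d y) _ _))
      ∑d≡dp+dq : sum d ≡ d p + d q
      ∑d≡dp+dq = begin
        sum d                                               ≡⟨ sum-cong-≗ on-pair ⟩
        sum (λ y → d y * δ p y + d y * δ q y)               ≡⟨ ∑-distrib-+ (λ y → d y * δ p y) (λ y → d y * δ q y) ⟩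
        sum (λ y → d y * δ p y) + sum (λ y → d y * δ q y)   ≡⟨ cong₂ _+_ (∑-δ d p) (∑-δ d q) ⟩
        d p + d q                                           ∎
      ∑d≡0 : sum d ≡ 0ℤ
      ∑d≡0 = begin
        sum d                                                     ≡⟨ ∑d≡dp+dq ⟩
        d p + d q                                                 ≡⟨ halve (d p) (d q) ⟩
        + 2 * (d p + d q) + -1ℤ * (d q + d p)
            ≡⟨ cong₂ (λ t u → + 2 * t + -1ℤ * u) ∑d≡dp+dq (cong₂ _+_ (cong d (⊖-left p q)) (cong d (⊖-right p q))) ⟨
        + 2 * sum d + -1ℤ * (d ((p ∙ q) ⊖ p) + d ((p ∙ q) ⊖ q))   ≡⟨ formula (p ∙ q) ⟩
        0ℤ                                                        ∎

    -- Taking z = y ∙ p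
    -- gives d y + d (y ∙ r) = 0; since A and B cover the group this means y ∈ B iff
    -- y ∙ r ∈ A (and y ∈ A iff y ∙ r ∈ B).  At y = p it follows that p ∙ r ∈ A ∩ B iff
    -- p ∈ A ∩ B, so p ∙ r ∈ {p , q}; p ∙ r = p would force r = ε, and p ∙ r = q gives
    -- r ∙ r = ε.
    antiperiodic⇒translate : ∀ {p q} → p ≢ q → (∀ y y′ → both y ≡ both y′ → pair p q y ≡ pair p q y′) →
      (∀ z → d (z ⊖ p) + d (z ⊖ q) ≡ 0ℤ) →
      (p ⊖ q ≢ ε) × ((p ⊖ q) ∙ (p ⊖ q) ≡ ε) × (∀ y → lookup B y ≡ lookup A (y ∙ (p ⊖ q)))
    antiperiodic⇒translate {p} {q} p≢q determined antiperiodic = r≢ε , r∙r≡ε , (λ y → proj₁ (swapped y))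
      where
      r = p ⊖ q
      antiperiod : ∀ y → d y + d (y ∙ r) ≡ 0ℤ
      antiperiod y =
        subst₂ (λ u v → d u + d v ≡ 0ℤ) (//-rightDividesʳ p y) (assoc y p (q ⁻¹)) (antiperiodic (y ∙ p))
      swapped : ∀ y → lookup B y ≡ lookup A (y ∙ r) × lookup A y ≡ lookup B (y ∙ r)
      swapped y = cover-opposite _ _ _ _ (cover y) (cover (y ∙ r)) (antiperiod y)
      r≢ε : r ≢ ε
      r≢ε r≡ε = p≢q (x∙y⁻¹≈ε⇒x≈y p q r≡ε)
      same-membership : both (p ∙ r) ≡ both p
      same-membership =
        trans (cong₂ _∧_ (sym (proj₁ (swapped p))) (sym (proj₂ (swapped p)))) (∧-comm (lookup B p) (lookup A p))
      r∙r≡ε : r ∙ r ≡ ε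
      r∙r≡ε with pair-cases (trans (determined (p ∙ r) p same-membership) (pair-left p q))
      ... | inj₁ p∙r≡p = contradiction (trans (⊖-unique p∙r≡p) (inverseʳ p)) r≢ε
      ... | inj₂ p∙r≡q = begin
        r ∙ r             ≡⟨ assoc r p (q ⁻¹) ⟨
        (r ∙ p) ∙ (q ⁻¹)  ≡⟨ cong (_∙ (q ⁻¹)) (trans (comm r p) p∙r≡q) ⟩
        q ∙ (q ⁻¹)        ≡⟨ inverseʳ q ⟩
        ε                 ∎

    equal-rep⇒translate : ∣ A ∩ B ∣ ≡ 2 ⊎ ∣ ∁ (A ∩ B) ∣ ≡ 2 → (∀ z → rep A z ≡ rep B z) →
      Σ (Fin n) λ r → r ≢ ε × r ∙ r ≡ ε × (∀ y → lookup B y ≡ lookup A (y ∙ r))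
    equal-rep⇒translate (inj₁ ∣A∩B∣≡2) rA≡rB with two-element (A ∩ B) ∣A∩B∣≡2
    ... | p , q , p≢q , A∩B≡pq =
      p ⊖ q , antiperiodic⇒translate p≢q determined (small-intersection p≢q both≡pair (equal-rep⇒d⋆s≡0 rA≡rB))
      where
      both≡pair : ∀ y → both y ≡ pair p q y
      both≡pair y = trans (sym (lookup-zipWith _∧_ y A B)) (A∩B≡pq y)
      determined : ∀ y y′ → both y ≡ both y′ → pair p q y ≡ pair p q y′
      determined y y′ e = trans (sym (both≡pair y)) (trans e (both≡pair y′))
    equal-rep⇒translate (inj₂ ∣∁A∩B∣≡2) rA≡rB with two-element (∁ (A ∩ B)) ∣∁A∩B∣≡2
    ... | p , q , p≢q , ∁A∩B≡pq =
      p ⊖ q , antiperiodic⇒translate p≢q determined (large-intersection p≢q both≡copair (equal-rep⇒d⋆s≡0 rA≡rB))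
      where
      both≡copair : ∀ y → both y ≡ not (pair p q y)
      both≡copair y = begin
        both y                      ≡⟨ lookup-zipWith _∧_ y A B ⟨
        lookup (A ∩ B) y            ≡⟨ not-involutive (lookup (A ∩ B) y) ⟨
        not (not (lookup (A ∩ B) y)) ≡⟨ cong not (trans (sym (lookup-map y not (A ∩ B))) (∁A∩B≡pq y)) ⟩
        not (pair p q y)            ∎
      determined : ∀ y y′ → both y ≡ both y′ → pair p q y ≡ pair p q y′
      determined y y′ e = not-injective (trans (sym (both≡copair y)) (trans e (both≡copair y′)))

module ZMod (k : ℕ) where

  N : ℕ
  N = suc k

  -ₘ_ : Fin N → Fin N
  -ₘ x = [ N ∸ toℕ x ]ₘ

  toℕ-[]ₘ : ∀ a → toℕ ([_]ₘ {N} a) ≡ a % N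
  toℕ-[]ₘ a = toℕ-fromℕ< (ℕ.m%n<n a N)

  []ₘ-cong : ∀ a b → a % N ≡ b % N → [_]ₘ {N} a ≡ [ b ]ₘ
  []ₘ-cong a b a≡b = toℕ-injective (trans (toℕ-[]ₘ a) (trans a≡b (sym (toℕ-[]ₘ b))))

  []ₘ-toℕ : ∀ (x : Fin N) → [ toℕ x ]ₘ ≡ x
  []ₘ-toℕ x = toℕ-injective (trans (toℕ-[]ₘ (toℕ x)) (ℕ.m<n⇒m%n≡m (toℕ<n x)))

  []ₘ-+ : ∀ a b → [_]ₘ {N} a +ₘ [ b ]ₘ ≡ [ a ℕ.+ b ]ₘ
  []ₘ-+ a b = []ₘ-cong (toℕ ([_]ₘ {N} a) ℕ.+ toℕ ([_]ₘ {N} b)) (a ℕ.+ b) (begin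
    (toℕ ([_]ₘ {N} a) ℕ.+ toℕ ([_]ₘ {N} b)) % N  ≡⟨ cong₂ (λ u v → (u ℕ.+ v) % N) (toℕ-[]ₘ a) (toℕ-[]ₘ b) ⟩
    (a % N ℕ.+ b % N) % N                          ≡⟨ ℕ.%-distribˡ-+ a b N ⟨
    (a ℕ.+ b) % N                                  ∎)

  +ₘ-comm : ∀ (x y : Fin N) → x +ₘ y ≡ y +ₘ x
  +ₘ-comm x y = cong [_]ₘ (ℕ.+-comm (toℕ x) (toℕ y))

  +ₘ-assoc : ∀ (x y z : Fin N) → (x +ₘ y) +ₘ z ≡ x +ₘ (y +ₘ z)
  +ₘ-assoc x y z = begin
    (x +ₘ y) +ₘ z                                  ≡⟨ cong ((x +ₘ y) +ₘ_) ([]ₘ-toℕ z) ⟨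
    [ toℕ x ℕ.+ toℕ y ]ₘ +ₘ [ toℕ z ]ₘ             ≡⟨ []ₘ-+ (toℕ x ℕ.+ toℕ y) (toℕ z) ⟩
    [ toℕ x ℕ.+ toℕ y ℕ.+ toℕ z ]ₘ                 ≡⟨ cong [_]ₘ (ℕ.+-assoc (toℕ x) (toℕ y) (toℕ z)) ⟩
    [ toℕ x ℕ.+ (toℕ y ℕ.+ toℕ z) ]ₘ               ≡⟨ []ₘ-+ (toℕ x) (toℕ y ℕ.+ toℕ z) ⟨
    [ toℕ x ]ₘ +ₘ [ toℕ y ℕ.+ toℕ z ]ₘ             ≡⟨ cong (_+ₘ (y +ₘ z)) ([]ₘ-toℕ x) ⟩
    x +ₘ (y +ₘ z)                                  ∎

  +ₘ-identityˡ : ∀ (x : Fin N) → fzero +ₘ x ≡ x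
  +ₘ-identityˡ = []ₘ-toℕ

  +ₘ-inverseˡ : ∀ (x : Fin N) → (-ₘ x) +ₘ x ≡ fzero
  +ₘ-inverseˡ x = begin
    (-ₘ x) +ₘ x                   ≡⟨ cong ((-ₘ x) +ₘ_) ([]ₘ-toℕ x) ⟨
    [ N ∸ toℕ x ]ₘ +ₘ [ toℕ x ]ₘ  ≡⟨ []ₘ-+ (N ∸ toℕ x) (toℕ x) ⟩
    [ N ∸ toℕ x ℕ.+ toℕ x ]ₘ      ≡⟨ cong [_]ₘ (ℕ.m∸n+n≡m (ℕ.<⇒≤ (toℕ<n x))) ⟩
    [ N ]ₘ                        ≡⟨ []ₘ-cong N 0 (ℕ.n%n≡0 N) ⟩
    fzero                         ∎

  +ₘ-isAbelianGroup : IsAbelianGroup _≡_ (_+ₘ_ {N}) fzero -ₘ_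
  +ₘ-isAbelianGroup = record
    { isGroup = record
      { isMonoid = record
        { isSemigroup = record
          { isMagma = record { isEquivalence = isEquivalence ; ∙-cong = cong₂ _+ₘ_ }
          ; assoc = +ₘ-assoc
          }
        ; identity = comm∧idˡ⇒id +ₘ-comm +ₘ-identityˡ
        }
      ; inverse = comm∧invˡ⇒inv +ₘ-comm +ₘ-inverseˡ
      ; ⁻¹-cong = cong -ₘ_
      }
    ; comm = +ₘ-comm
    }

  open OnAbelianGroup +ₘ-isAbelianGroup public

  R≡rep : ∀ A z → + R A z ≡ rep A z
  R≡rep = count-pairs≡rep

  lookup-+ₛ : ∀ (A : Subset N) c y → lookup (A +ₛ c) y ≡ lookup A (y ⊖ c)
  lookup-+ₛ A c y = trans (lookup∘tabulate (λ x → does (translate? x)) y) (decide (translate? y))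
    where
    translate? : ∀ x → Dec (∃ λ a → a ∈ A × a +ₘ c ≡ x)
    translate? x = any? λ a → (a ∈? A) ×-dec ((a +ₘ c) ≟ x)
    decide : (d : Dec (∃ λ a → a ∈ A × a +ₘ c ≡ y)) → does d ≡ lookup A (y ⊖ c)
    decide (yes (a , a∈A , a+c≡y)) = begin
      true               ≡⟨ []=⇒lookup a∈A ⟨
      lookup A a         ≡⟨ cong (lookup A) (⊖-unique {c} {a} {y} (trans (+ₘ-comm c a) a+c≡y)) ⟩
      lookup A (y ⊖ c)   ∎
    decide (no ∄a) with lookup A (y ⊖ c) in y⊖c∈A
    ... | true  = contradiction (y ⊖ c , lookup⇒[]= (y ⊖ c) A y⊖c∈A , y⊖c+c≡y) ∄a
      where
      y⊖c+c≡y : (y ⊖ c) +ₘ c ≡ y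
      y⊖c+c≡y = trans (+ₘ-comm (y ⊖ c) c) (⊖-solves c y)
    ... | false = refl

  -- The residue of N / 2; for even N it is the unique element of order two.
  h : Fin N
  h = [ N / 2 ]ₘ

  toℕ-h : toℕ h ≡ N / 2
  toℕ-h = trans (toℕ-[]ₘ (N / 2)) (ℕ.m<n⇒m%n≡m (ℕ.m/n<m N 2 (ℕ.s≤s (ℕ.s≤s ℕ.z≤n))))

  m+m≡m*2 : ∀ a → a ℕ.+ a ≡ a ℕ.* 2
  m+m≡m*2 a = trans (cong (a ℕ.+_) (sym (ℕ.+-identityʳ a))) (ℕ.*-comm 2 a)

  h+h≡0 : 2 ∣ N → h +ₘ h ≡ fzero
  h+h≡0 2∣N = []ₘ-cong (toℕ h ℕ.+ toℕ h) 0 (begin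
    (toℕ h ℕ.+ toℕ h) % N    ≡⟨ cong (λ t → (t ℕ.+ t) % N) toℕ-h ⟩
    (N / 2 ℕ.+ N / 2) % N    ≡⟨ cong (_% N) (trans (m+m≡m*2 (N / 2)) (ℕ.m/n*n≡m 2∣N)) ⟩
    N % N                    ≡⟨ ℕ.n%n≡0 N ⟩
    0                        ∎)

  -- A nonzero r with r + r = 0 has 2·toℕ r = N (it is less than 2N), so r = h.
  order-two⇒h : ∀ r → r +ₘ r ≡ fzero → r ≢ fzero → r ≡ h
  order-two⇒h r r+r≡0 r≢0 with m%n≡0⇒n∣m (toℕ r ℕ.+ toℕ r) N 2r%N≡0
    where
    2r%N≡0 : (toℕ r ℕ.+ toℕ r) % N ≡ 0
    2r%N≡0 = trans (sym (toℕ-[]ₘ (toℕ r ℕ.+ toℕ r))) (cong toℕ r+r≡0)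
  ... | divides 0 2r≡0 = contradiction (toℕ-injective (ℕ.m+n≡0⇒m≡0 (toℕ r) 2r≡0)) r≢0
  ... | divides 1 2r≡N = toℕ-injective (begin
    toℕ r                 ≡⟨ ℕ.m*n/n≡m (toℕ r) 2 ⟨
    toℕ r ℕ.* 2 / 2       ≡⟨ cong (_/ 2) (trans (sym (m+m≡m*2 (toℕ r))) (trans 2r≡N (ℕ.+-identityʳ N))) ⟩
    N / 2                 ≡⟨ toℕ-h ⟨
    toℕ h                 ∎)
  ... | divides (suc (suc j)) 2r≡[2+j]N = contradiction 2r≡[2+j]N (ℕ.<⇒≢ (ℕ.<-≤-trans
          (ℕ.+-mono-< (toℕ<n r) (toℕ<n r)) (ℕ.+-monoʳ-≤ N (ℕ.m≤m+n N (j ℕ.* N)))))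

  -- For even N, h is its own negative, so B = A + h iff y ∈ B ⇔ y + h ∈ A.
  translate-by-h : 2 ∣ N → ∀ (A B : Subset N) → B ≡ A +ₛ h ⇔ (∀ y → lookup B y ≡ lookup A (y +ₘ h))
  translate-by-h 2∣N A B = mk⇔
    (λ B≡A+h y → trans (cong (λ V → lookup V y) B≡A+h) (lookup-+h y))
    (λ B≡A+h → trans (sym (tabulate∘lookup B))
                 (trans (tabulate-cong (λ y → trans (B≡A+h y) (sym (lookup-+h y)))) (tabulate∘lookup (A +ₛ h))))
    where
    lookup-+h : ∀ y → lookup (A +ₛ h) y ≡ lookup A (y +ₘ h)
    lookup-+h y = trans (lookup-+ₛ A h y) (cong (lookup A) (⊖-order-two (h+h≡0 2∣N) y))


theorem1p1 : (m : ℕ) .{{_ : NonZero m}} → 2 ∣ m →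
    (A B : Subset m) → A ∪ B ≡ ⊤ →
    (∣ A ∩ B ∣ ≡ 2 ⊎ ∣ A ∩ B ∣ ≡ m ∸ 2) →
    (((n : Fin m) → R A n ≡ R B n) ⇔ (B ≡ A +ₛ [ m / 2 ]ₘ))
theorem1p1 (suc k) 2∣m A B A∪B≡⊤ ∣A∩B∣≡2∨m-2 = mk⇔ forward backward
  where
  open ZMod k

  cover : ∀ y → lookup A y ∨ lookup B y ≡ true
  cover y = begin
    lookup A y ∨ lookup B y  ≡⟨ lookup-zipWith _∨_ y A B ⟨
    lookup (A ∪ B) y         ≡⟨ cong (λ V → lookup V y) A∪B≡⊤ ⟩
    lookup ⊤ y               ≡⟨ lookup-replicate y true ⟩
    true                     ∎

  -- Since m ≥ 2, |A ∩ B| = m − 2 says that the complement of A ∩ B has two elements.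
  two-points : ∣ A ∩ B ∣ ≡ 2 ⊎ ∣ ∁ (A ∩ B) ∣ ≡ 2
  two-points = map₂ complement-two ∣A∩B∣≡2∨m-2
    where
    complement-two : ∣ A ∩ B ∣ ≡ N ∸ 2 → ∣ ∁ (A ∩ B) ∣ ≡ 2
    complement-two e = trans (∣∁p∣≡n∸∣p∣ (A ∩ B)) (trans (cong (N ∸_) e) (ℕ.m∸[m∸n]≡n (∣⇒≤ 2∣m)))

  equal-reps : (∀ z → R A z ≡ R B z) → ∀ z → rep A z ≡ rep B z
  equal-reps R≡ z = trans (sym (R≡rep A z)) (trans (cong +_ (R≡ z)) (R≡rep B z))

  forward : (∀ z → R A z ≡ R B z) → B ≡ A +ₛ h
  forward R≡ with Covering.equal-rep⇒translate A B cover two-points (equal-reps R≡)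
  ... | r , r≢0 , r+r≡0 , B≡A+r = Equivalence.from (translate-by-h 2∣m A B) B≡A+h
    where
    B≡A+h : ∀ y → lookup B y ≡ lookup A (y +ₘ h)
    B≡A+h y = subst (λ c → lookup B y ≡ lookup A (y +ₘ c)) (order-two⇒h r r+r≡0 r≢0) (B≡A+r y)

  backward : B ≡ A +ₛ h → ∀ z → R A z ≡ R B z
  backward B≡A+h z = +-injective (begin
    + R A z  ≡⟨ R≡rep A z ⟩
    rep A z  ≡⟨ rep-translate A B h (h+h≡0 2∣m) (Equivalence.to (translate-by-h 2∣m A B) B≡A+h) z ⟨
    rep B z  ≡⟨ R≡rep B z ⟨
    + R B z  ∎)
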